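{- Let $\mathbf{L}=\langle L,\wedge,\vee\rangle$ be a complete lattice with induced order $\leq$ and bottom element $0$. Then $\mathbf{L}'=\langle L,\leq,\vee,0\rangle$ is a dually integral Abelian pomonoid; every GTCR on $\mathbf{L}$ is a deductive relation on $\mathbf{L}'$, and every finitary GTCR on $\mathbf{L}$ is a finitary deductive relation on $\mathbf{L}'$.
   Context: A dually integral Abelian pomonoid is $\langle R,\leq,+,0\rangle$ with $\langle R,+,0\rangle$ a commutative monoid, $\leq$ a partial order with $a\leq b\Rightarrow a+c\leq b+c$, and $0$ least. A deductive relation on it is a relation $\vdash$ on $R$ with: $a\leq b\Rightarrow b\vdash a$; $a\vdash b,b\vdash c\Rightarrow a\vdash c$; $a\vdash b\Rightarrow a+c\vdash b+c$. A Galatos–Tsinakis consequence relation (GTCR) on a complete lattice $\mathbf{L}$ is a preorder $\vdash$ on $L$ containing $\geq$ (i.e. $a\geq b$ implies $a\vdash b$) such that $x\vdash\bigvee\{y\in L:x\vdash y\}$ for all $x\in L$. An element $a$ is compact if for every directed set $D$ having a supremum $\sup D\geq a$ there is $d\in D$ with $d\geq a$. A relation $\vdash$ (DR or GTCR) is finitary if whenever $a\vdash b$ with $b$ compact, there is a compact $a'\leq a$ with $a'\vdash b$. -}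

module Defs where

open import Level using (Level; _⊔_; suc; Lift)
open import Data.Empty using (⊥)
open import Data.Product using (Σ; ∃; _×_; _,_)
open import Relation.Binary.Core using (Rel)
open import Relation.Binary.Structures using (IsPartialOrder)
open import Relation.Binary.Lattice.Bundles using (Lattice)
open import Algebra.Core using (Op₂)
open import Algebra.Structures using (IsCommutativeMonoid)

IsLUB : ∀ {a ℓ ℓs} {A : Set a} → Rel A ℓ → (A → Set ℓs) → A → Set (a ⊔ ℓ ⊔ ℓs)
IsLUB _≤_ S s = (∀ {x} → S x → x ≤ s) × (∀ u → (∀ {x} → S x → x ≤ u) → s ≤ u)

record CompleteLattice (c ℓ₁ ℓ₂ ℓs : Level) : Set (suc (c ⊔ ℓ₁ ⊔ ℓ₂ ⊔ ℓs)) where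
  field
    lattice : Lattice c ℓ₁ ℓ₂
  open Lattice lattice public
  field
    ⋁      : (Carrier → Set ℓs) → Carrier
    ⋁-lub  : ∀ S → IsLUB _≤_ S (⋁ S)

  bot : Carrier
  bot = ⋁ (λ _ → Lift ℓs ⊥)

record IsDIAPomonoid {r ℓ₁ ℓ₂} {R : Set r} (_≈_ : Rel R ℓ₁) (_≤_ : Rel R ℓ₂)
                     (_+_ : Op₂ R) (0# : R) : Set (r ⊔ ℓ₁ ⊔ ℓ₂) where
  field
    isCommutativeMonoid : IsCommutativeMonoid _≈_ _+_ 0#
    isPartialOrder      : IsPartialOrder _≈_ _≤_
    +-mono              : ∀ {a b} c → a ≤ b → (a + c) ≤ (b + c)
    0-least             : ∀ a → 0# ≤ a

record IsDeductive {r ℓ₂ ℓd} {R : Set r} (_≤_ : Rel R ℓ₂) (_+_ : Op₂ R)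
                   (_⊢_ : Rel R ℓd) : Set (r ⊔ ℓ₂ ⊔ ℓd) where
  field
    ≤⇒⊢    : ∀ {a b} → a ≤ b → b ⊢ a
    ⊢-trans : ∀ {a b c} → a ⊢ b → b ⊢ c → a ⊢ c
    ⊢-+     : ∀ {a b} c → a ⊢ b → (a + c) ⊢ (b + c)

record IsGTCR {c ℓ₁ ℓ₂ ℓs} (L : CompleteLattice c ℓ₁ ℓ₂ ℓs)
              (_⊢_ : Rel (CompleteLattice.Carrier L) ℓs) : Set (c ⊔ ℓ₂ ⊔ ℓs) where
  open CompleteLattice L
  field
    ⊢-refl  : ∀ {a} → a ⊢ a
    ⊢-trans : ∀ {a b c} → a ⊢ b → b ⊢ c → a ⊢ c
    ≥⇒⊢    : ∀ {a b} → b ≤ a → a ⊢ b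
    ⊢-⋁     : ∀ x → x ⊢ ⋁ (λ y → x ⊢ y)

Directed : ∀ {a ℓ ℓs} {A : Set a} → Rel A ℓ → (A → Set ℓs) → Set (a ⊔ ℓ ⊔ ℓs)
Directed {A = A} _≤_ D =
  (Σ A D) × (∀ {x y} → D x → D y → Σ A (λ z → D z × (x ≤ z × y ≤ z)))

IsCompact : ∀ {a ℓ} (ℓs : Level) {A : Set a} → Rel A ℓ → A → Set (a ⊔ ℓ ⊔ suc ℓs)
IsCompact ℓs {A} _≤_ a =
  ∀ (D : A → Set ℓs) → Directed _≤_ D → ∀ s → IsLUB _≤_ D s → a ≤ s →
    Σ A (λ d → D d × a ≤ d)

Finitary : ∀ {a ℓ ℓd} (ℓs : Level) {A : Set a} → Rel A ℓ → Rel A ℓd → Set (a ⊔ ℓ ⊔ ℓd ⊔ suc ℓs)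
Finitary ℓs {A} _≤_ _⊢_ =
  ∀ {a b} → a ⊢ b → IsCompact ℓs _≤_ b →
    Σ A (λ a' → IsCompact ℓs _≤_ a' × (a' ≤ a × a' ⊢ b))

-- Joins form a commutative monoid with unit the bottom element, and joining is
-- monotone, so any bounded join semilattice is such a pomonoid.  For a GTCR,
-- every consequence of x lies below ⋁{y : x ⊢ y}, which x entails, so x entails
-- the join of any two of its consequences; if a ⊢ b then a ∨ c entails both b
-- and c, hence b ∨ c.  Finitariness means the same for GTCRs and deductive
-- relations.
module Submission where

open import Defs
open import Data.Product using (_×_; _,_; proj₁; proj₂)
open import Relation.Binary.Core using (Rel)
open import Relation.Binary.Lattice.Bundles using (BoundedJoinSemilattice)
import Relation.Binary.Lattice.Properties.BoundedJoinSemilattice as BoundedJoinSemilatticeProperties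
import Relation.Binary.Lattice.Properties.JoinSemilattice as JoinSemilatticeProperties

boundedJoinSemilattice⇒isDIAPomonoid : ∀ {c ℓ₁ ℓ₂} (J : BoundedJoinSemilattice c ℓ₁ ℓ₂) →
  let open BoundedJoinSemilattice J in IsDIAPomonoid _≈_ _≤_ _∨_ ⊥
boundedJoinSemilattice⇒isDIAPomonoid J = record
  { isCommutativeMonoid = record
    { isMonoid = record
      { isSemigroup = record
        { isMagma = record { isEquivalence = isEquivalence ; ∙-cong = ∨-cong }
        ; assoc   = ∨-assoc
        }
      ; identity = identity
      }
    ; comm = ∨-comm
    }
  ; isPartialOrder = isPartialOrder
  ; +-mono         = λ _ a≤b → ∨-monotonic a≤b refl
  ; 0-least        = minimum
  }
  where
  open BoundedJoinSemilattice J
  open BoundedJoinSemilatticeProperties J using (identity)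
  open JoinSemilatticeProperties joinSemilattice using (∨-cong; ∨-assoc; ∨-comm; ∨-monotonic)

module _ {c ℓ₁ ℓ₂ ℓs} (L : CompleteLattice c ℓ₁ ℓ₂ ℓs) where
  open CompleteLattice L

  bot-minimum : ∀ a → bot ≤ a
  bot-minimum a = proj₂ (⋁-lub _) a (λ ())

  boundedJoinSemilattice : BoundedJoinSemilattice c ℓ₁ ℓ₂
  boundedJoinSemilattice = record
    { ⊥                        = bot
    ; isBoundedJoinSemilattice = record
      { isJoinSemilattice = isJoinSemilattice
      ; minimum           = bot-minimum
      }
    }

  module _ {_⊢_ : Rel Carrier ℓs} (gtcr : IsGTCR L _⊢_) where
    open IsGTCR gtcr

    ⊢-∨ : ∀ {x a b} → x ⊢ a → x ⊢ b → x ⊢ (a ∨ b)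
    ⊢-∨ {x} x⊢a x⊢b =
      ⊢-trans (⊢-⋁ x) (≥⇒⊢ (∨-least (consequence≤⋁ x⊢a) (consequence≤⋁ x⊢b)))
      where consequence≤⋁ = proj₁ (⋁-lub (x ⊢_))

    ⊢-∨ʳ : ∀ {a b} c → a ⊢ b → (a ∨ c) ⊢ (b ∨ c)
    ⊢-∨ʳ {a} c a⊢b = ⊢-∨ (⊢-trans (≥⇒⊢ (x≤x∨y a c)) a⊢b) (≥⇒⊢ (y≤x∨y a c))

    isGTCR⇒isDeductive : IsDeductive _≤_ _∨_ _⊢_
    isGTCR⇒isDeductive = record
      { ≤⇒⊢    = ≥⇒⊢
      ; ⊢-trans = ⊢-trans
      ; ⊢-+     = ⊢-∨ʳ
      }

proposition3p5 : ∀ {c ℓ₁ ℓ₂ ℓs} (L : CompleteLattice c ℓ₁ ℓ₂ ℓs) →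
    IsDIAPomonoid (CompleteLattice._≈_ L) (CompleteLattice._≤_ L) (CompleteLattice._∨_ L) (CompleteLattice.bot L)
    × (∀ (⊢ : Rel (CompleteLattice.Carrier L) ℓs) → IsGTCR L ⊢ → IsDeductive (CompleteLattice._≤_ L) (CompleteLattice._∨_ L) ⊢)
    × (∀ (⊢ : Rel (CompleteLattice.Carrier L) ℓs) → IsGTCR L ⊢ → Finitary ℓs (CompleteLattice._≤_ L) ⊢ →
    IsDeductive (CompleteLattice._≤_ L) (CompleteLattice._∨_ L) ⊢ × Finitary ℓs (CompleteLattice._≤_ L) ⊢)
proposition3p5 L =
    boundedJoinSemilattice⇒isDIAPomonoid (boundedJoinSemilattice L)
  , (λ _ gtcr → isGTCR⇒isDeductive L gtcr)
  , (λ _ gtcr finitary → isGTCR⇒isDeductive L gtcr , finitary)
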